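{- For every integer $n\geq 3$ and every $m\in\{3,6,9,\dots,3n-6\}$, there is a planar graph $G$ with $n$ vertices and $m$ edges having exactly $n+\frac{7}{3}m-2$ cliques.
   Context: All graphs are finite, simple and undirected. A clique is a (possibly empty) set of pairwise adjacent vertices; the number of cliques counts $\emptyset$ and single vertices. -}

module Defs where

open import Data.Bool using (Bool; true; false; _∧_; _∨_; not; if_then_else_)
open import Data.Nat using (ℕ; zero; suc; _+_; _<ᵇ_)
open import Data.Fin using (Fin; toℕ; _≟_)
open import Data.Vec using (Vec; []; _∷_; lookup)
open import Data.List using (List; []; _∷_; map; _++_; allFin; length; filterᵇ; concatMap)
open import Data.Bool.ListAction using (and)
open import Data.Product using (_×_; _,_; ∃; Σ)
open import Data.Sum using (_⊎_)
open import Relation.Nullary using (¬_; does)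
open import Relation.Binary.PropositionalEquality using (_≡_)
open import Function.Definitions using (Injective)
open import Data.Rational using (ℚ; 0ℚ; 1ℚ; _≤_) renaming (_+_ to _+q_; _*_ to _*q_; _-_ to _-q_)

record Graph (n : ℕ) : Set where
  field
    adj   : Fin n → Fin n → Bool
    sym   : ∀ i j → adj i j ≡ adj j i
    irrefl : ∀ i → adj i i ≡ false
open Graph public

edgeCount : ∀ {n} → Graph n → ℕ
edgeCount {n} G =
  length (filterᵇ (λ { (i , j) → (toℕ i <ᵇ toℕ j) ∧ adj G i j })
                  (concatMap (λ i → map (i ,_) (allFin n)) (allFin n)))

allSubsets : (n : ℕ) → List (Vec Bool n)
allSubsets zero = [] ∷ []
allSubsets (suc n) = map (true ∷_) (allSubsets n) ++ map (false ∷_) (allSubsets n)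

allᵇ : {A : Set} → (A → Bool) → List A → Bool
allᵇ p xs = and (map p xs)

isCliqueᵇ : ∀ {n} → Graph n → Vec Bool n → Bool
isCliqueᵇ {n} G S =
  allᵇ (λ i → allᵇ (λ j →
    not (lookup S i ∧ lookup S j) ∨ does (i ≟ j) ∨ adj G i j) (allFin n)) (allFin n)

-- Number of cliques (including the empty clique and single vertices).
cliqueCount : ∀ {n} → Graph n → ℕ
cliqueCount {n} G = length (filterᵇ (isCliqueᵇ G) (allSubsets n))

Point : Set
Point = ℚ × ℚ

OnSegment : Point → Point → Point → Set
OnSegment (px , py) (ax , ay) (bx , by) =
  Σ ℚ λ t → (0ℚ ≤ t) × (t ≤ 1ℚ) ×
    (px ≡ ax +q t *q (bx -q ax)) × (py ≡ ay +q t *q (by -q ay))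

record PlanarDrawing {n : ℕ} (G : Graph n) : Set where
  field
    pos : Fin n → Point
    pos-injective : Injective _≡_ _≡_ pos
    vertex-off-edges : ∀ v a b → adj G a b ≡ true →
      OnSegment (pos v) (pos a) (pos b) → (v ≡ a) ⊎ (v ≡ b)
    edges-noncrossing : ∀ a b c d → adj G a b ≡ true → adj G c d ≡ true →
      ¬ ((a ≡ c) × (b ≡ d)) → ¬ ((a ≡ d) × (b ≡ c)) →
      ∀ p → OnSegment p (pos a) (pos b) → OnSegment p (pos c) (pos d) →
      ∃ λ x → ((x ≡ a) ⊎ (x ≡ b)) × ((x ≡ c) ⊎ (x ≡ d)) × (p ≡ pos x)

-- By Fáry's theorem (and perturbation of vertex positions to rational points)
-- this is equivalent to the usual topological notion of planarity.
Planar : ∀ {n} → Graph n → Set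
Planar G = PlanarDrawing G

{-# OPTIONS --safe #-}
module Submission where

-- Let k = m / 3. Take two adjacent hubs, a path of k rim vertices each joined to both hubs, and
-- n - k - 2 isolated vertices. Building the graph one vertex at a time, a new vertex adds its
-- number of earlier neighbours to the edge count and the number of cliques among its earlier
-- neighbours to the clique count. The first rim vertex sees the two hubs (2 edges, 4 cliques),
-- every later one sees a triangle (3 edges, 8 cliques), an isolated vertex nothing (0 edges,
-- 1 clique); starting from the hub edge (1 edge, 4 cliques) this gives 3k edges and n + 7k - 2
-- cliques. Hubs at (0, ±1) and rim vertices at (2, 0), (3, 0), … give a straight-line drawing:
-- spokes of the upper hub stay in y ≥ 0 and those of the lower hub in y ≤ 0, and all of them
-- reach the x-axis only at their rim vertex.

open import Defs hiding (sym)
open import Data.Bool using (Bool; true; false; _∧_; _∨_; not; if_then_else_)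
open import Data.Bool.Properties using (∨-comm; ∨-identityʳ; ∧-identityʳ)
open import Data.Empty using (⊥-elim)
open import Data.Fin using (Fin; zero; suc; toℕ; _≟_)
open import Data.Fin.Properties using (suc-injective)
open import Data.List using (List; []; _∷_; map; _++_; allFin; length; filterᵇ; concatMap; tabulate)
open import Data.List.Membership.Propositional using (_∈_)
open import Data.List.Membership.Propositional.Properties using (∈-allFin)
open import Data.List.Properties using (filter-++; length-++; map-tabulate; map-cong)
open import Data.List.Relation.Unary.Any using (here; there)
open import Data.Nat using (ℕ; zero; suc; _+_; _*_; _∸_; _≤_; _<_; _<ᵇ_; _<?_; z≤n; s≤s)
  renaming (_≟_ to _≟ℕ_)
open import Data.Nat.Divisibility using (_∣_; divides)
open import Data.Nat.ListAction using (sum)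
open import Data.Nat.Properties
  using (+-comm; +-identityʳ; *-comm; *-suc; *-cancelˡ-≤; m∸n+n≡m; ≤-refl; ≤-antisym; ≤-pred;
         <⇒≤; <⇒≢; ≤⇒≯; <-irrefl; <-asym; <-cmp; m≤n⇒m≤1+n; m≤n+m; m≤n⇒m<n∨m≡n)
open import Data.Nat.Tactic.RingSolver using (solve-∀)
open import Data.Product using (Σ; ∃; _×_; _,_; proj₁; proj₂) renaming (map to map×; swap to swap×)
open import Data.Rational using (ℚ; 0ℚ; 1ℚ; -_; 1/_; ≢-nonZero)
  renaming (_+_ to _+ℚ_; _*_ to _*ℚ_; _-_ to _-ℚ_; _≤_ to _≤ℚ_)
import Data.Rational.Properties as ℚ
open import Data.Rational.Solver using (module +-*-Solver)
open +-*-Solver using (solve; _:=_; _:+_; _:*_; _:-_; :-_; con)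
open import Data.Sum using (_⊎_; inj₁; inj₂) renaming (map to map⊎; swap to swap⊎)
open import Data.Vec using (Vec; []; _∷_; lookup)
open import Function using (_∘_; id)
open import Function.Definitions using (Injective)
open import Relation.Binary.Definitions using (tri<; tri≈; tri>)
open import Relation.Binary.PropositionalEquality
  using (_≡_; _≢_; refl; sym; trans; cong; cong₂; subst; subst₂; module ≡-Reasoning)
open import Relation.Nullary using (¬_; Dec; does; yes; no)
open import Relation.Nullary.Decidable using (T?; dec-true; dec-false; from-yes; from-no)

-- Counting

indicator : Bool → ℕ
indicator true  = 1
indicator false = 0

count : {A : Set} → (A → Bool) → List A → ℕ
count p xs = length (filterᵇ p xs)

count-∷ : {A : Set} (p : A → Bool) (x : A) (xs : List A) → count p (x ∷ xs) ≡ indicator (p x) + count p xs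
count-∷ p x xs with p x
... | true  = refl
... | false = refl

count-++ : {A : Set} (p : A → Bool) (xs ys : List A) → count p (xs ++ ys) ≡ count p xs + count p ys
count-++ p xs ys = trans (cong length (filter-++ (T? ∘ p) xs ys)) (length-++ (filterᵇ p xs))

count-cong : {A : Set} {p q : A → Bool} → (∀ x → p x ≡ q x) → (xs : List A) → count p xs ≡ count q xs
count-cong e [] = refl
count-cong {p = p} {q} e (x ∷ xs) = begin
  count p (x ∷ xs)              ≡⟨ count-∷ p x xs ⟩
  indicator (p x) + count p xs  ≡⟨ cong₂ _+_ (cong indicator (e x)) (count-cong e xs) ⟩
  indicator (q x) + count q xs  ≡⟨ count-∷ q x xs ⟨
  count q (x ∷ xs)              ∎
  where open ≡-Reasoning

count-map : {A B : Set} (p : B → Bool) (f : A → B) (xs : List A) → count p (map f xs) ≡ count (p ∘ f) xs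
count-map p f []       = refl
count-map p f (x ∷ xs) = begin
  count p (f x ∷ map f xs)                  ≡⟨ count-∷ p (f x) (map f xs) ⟩
  indicator (p (f x)) + count p (map f xs)  ≡⟨ cong (indicator (p (f x)) +_) (count-map p f xs) ⟩
  indicator (p (f x)) + count (p ∘ f) xs    ≡⟨ count-∷ (p ∘ f) x xs ⟨
  count (p ∘ f) (x ∷ xs)                    ∎
  where open ≡-Reasoning

count-concatMap : {A B : Set} (p : B → Bool) (g : A → List B) (xs : List A) →
  count p (concatMap g xs) ≡ sum (map (count p ∘ g) xs)
count-concatMap p g []       = refl
count-concatMap p g (x ∷ xs) =
  trans (count-++ p (g x) (concatMap g xs)) (cong (count p (g x) +_) (count-concatMap p g xs))

count-false : {A : Set} (xs : List A) → count (λ _ → false) xs ≡ 0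
count-false []       = refl
count-false (_ ∷ xs) = count-false xs

count-∧ : {A : Set} (b : Bool) {q : A → Bool} (xs : List A) →
  count (λ x → b ∧ q x) xs ≡ (if b then count q xs else 0)
count-∧ true  xs = refl
count-∧ false xs = count-false xs

count-allFin-suc : ∀ {n} (p : Fin (suc n) → Bool) →
  count p (allFin (suc n)) ≡ indicator (p zero) + count (p ∘ suc) (allFin n)
count-allFin-suc {n} p = trans (count-∷ p zero (tabulate suc))
  (cong (indicator (p zero) +_) (trans (cong (count p) (sym (map-tabulate id suc))) (count-map p suc (allFin n))))

sum-allFin-suc : ∀ {n} (f : Fin (suc n) → ℕ) →
  sum (map f (allFin (suc n))) ≡ f zero + sum (map (f ∘ suc) (allFin n))
sum-allFin-suc {n} f =
  cong (λ xs → f zero + sum xs) (trans (map-tabulate suc f) (sym (map-tabulate id (f ∘ suc))))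

bool-extensionality : {a b : Bool} → (a ≡ true → b ≡ true) → (b ≡ true → a ≡ true) → a ≡ b
bool-extensionality {true}  {true}  _ _ = refl
bool-extensionality {true}  {false} f _ = sym (f refl)
bool-extensionality {false} {true}  _ g = g refl
bool-extensionality {false} {false} _ _ = refl

∧-true : {a b : Bool} → a ∧ b ≡ true → a ≡ true × b ≡ true
∧-true {true} {true} _ = refl , refl

∧-intro : {a b : Bool} → a ≡ true → b ≡ true → a ∧ b ≡ true
∧-intro refl refl = refl

∨-true : {a b : Bool} → a ∨ b ≡ true → a ≡ true ⊎ b ≡ true
∨-true {true}  _ = inj₁ refl
∨-true {false} e = inj₂ e

implication-sound : {a b : Bool} → not a ∨ b ≡ true → a ≡ true → b ≡ true
implication-sound {true} e refl = e

implication-complete : {a b : Bool} → (a ≡ true → b ≡ true) → not a ∨ b ≡ true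
implication-complete {false} _ = refl
implication-complete {true}  h = h refl

dec-true⁻¹ : ∀ {P : Set} (p? : Dec P) → does p? ≡ true → P
dec-true⁻¹ (yes p) _ = p

allᵇ-sound : {A : Set} (f : A → Bool) (xs : List A) → allᵇ f xs ≡ true → ∀ {x} → x ∈ xs → f x ≡ true
allᵇ-sound f (y ∷ xs) e (here refl)  = proj₁ (∧-true {f y} e)
allᵇ-sound f (y ∷ xs) e (there x∈xs) = allᵇ-sound f xs (proj₂ (∧-true {f y} e)) x∈xs

allᵇ-complete : {A : Set} (f : A → Bool) (xs : List A) → (∀ x → f x ≡ true) → allᵇ f xs ≡ true
allᵇ-complete f []       _ = refl
allᵇ-complete f (x ∷ xs) h = ∧-intro (h x) (allᵇ-complete f xs h)

allᵇ-allFin : ∀ {n} (f : Fin n → Bool) → allᵇ f (allFin n) ≡ true → ∀ i → f i ≡ true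
allᵇ-allFin {n} f e i = allᵇ-sound f (allFin n) e (∈-allFin i)

countBelow : (ℕ → Bool) → ℕ → ℕ
countBelow h zero    = 0
countBelow h (suc n) = indicator (h n) + countBelow h n

countBelow-cong : ∀ n {h g : ℕ → Bool} → (∀ x → x < n → h x ≡ g x) → countBelow h n ≡ countBelow g n
countBelow-cong zero    e = refl
countBelow-cong (suc n) e =
  cong₂ _+_ (cong indicator (e n ≤-refl)) (countBelow-cong n λ x x<n → e x (m≤n⇒m≤1+n x<n))

countBelow-skip : ∀ m d {h} → (∀ x → m ≤ x → x < d + m → h x ≡ false) →
  countBelow h (d + m) ≡ countBelow h m
countBelow-skip m zero    e = refl
countBelow-skip m (suc d) e rewrite e (d + m) (m≤n+m m d) ≤-refl =
  countBelow-skip m d λ x m≤x x<d+m → e x m≤x (m≤n⇒m≤1+n x<d+m)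

countBelow-empty : ∀ n {h} → (∀ x → x < n → h x ≡ false) → countBelow h n ≡ 0
countBelow-empty zero    e = refl
countBelow-empty (suc n) e rewrite e n ≤-refl = countBelow-empty n λ x x<n → e x (m≤n⇒m≤1+n x<n)

_∩_ : (ℕ → Bool) → (ℕ → Bool) → ℕ → Bool
(P ∩ Q) v = P v ∧ Q v

-- Rational geometry

0≤1 : 0ℚ ≤ℚ 1ℚ
0≤1 = from-yes (0ℚ ℚ.≤? 1ℚ)

1≰0 : ¬ 1ℚ ≤ℚ 0ℚ
1≰0 = from-no (1ℚ ℚ.≤? 0ℚ)

p≤p+q : ∀ p {q} → 0ℚ ≤ℚ q → p ≤ℚ p +ℚ q
p≤p+q p {q} 0≤q = subst (_≤ℚ p +ℚ q) (ℚ.+-identityʳ p) (ℚ.+-monoʳ-≤ p 0≤q)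

p≤q⇒0≤q-p : ∀ {p q} → p ≤ℚ q → 0ℚ ≤ℚ q -ℚ p
p≤q⇒0≤q-p {p} {q} p≤q = subst (_≤ℚ q -ℚ p) (ℚ.+-inverseʳ p) (ℚ.+-monoˡ-≤ (- p) p≤q)

+-cancelˡ-≤ : ∀ r {p q} → r +ℚ p ≤ℚ r +ℚ q → p ≤ℚ q
+-cancelˡ-≤ r {p} {q} le = subst₂ _≤ℚ_ (cancel p) (cancel q) (ℚ.+-monoʳ-≤ (- r) le)
  where
  cancel : ∀ x → - r +ℚ (r +ℚ x) ≡ x
  cancel = solve 2 (λ r x → (:- r) :+ (r :+ x) := x) refl r

nonNeg+nonNeg≡0 : ∀ {p q} → 0ℚ ≤ℚ p → 0ℚ ≤ℚ q → p +ℚ q ≡ 0ℚ → p ≡ 0ℚ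
nonNeg+nonNeg≡0 {p} 0≤p 0≤q e = ℚ.≤-antisym (subst (p ≤ℚ_) e (p≤p+q p 0≤q)) 0≤p

*-cancelˡ-≡ : ∀ r {p q} → r ≢ 0ℚ → r *ℚ p ≡ r *ℚ q → p ≡ q
*-cancelˡ-≡ r {p} {q} r≢0 e = begin
  p                 ≡⟨ divide p ⟩
  1/ r *ℚ (r *ℚ p)  ≡⟨ cong (1/ r *ℚ_) e ⟩
  1/ r *ℚ (r *ℚ q)  ≡⟨ divide q ⟨
  q                 ∎
  where
  open ≡-Reasoning
  instance _ = ≢-nonZero r≢0
  divide : ∀ x → x ≡ 1/ r *ℚ (r *ℚ x)
  divide x = begin
    x                 ≡⟨ ℚ.*-identityˡ x ⟨
    1ℚ *ℚ x           ≡⟨ cong (_*ℚ x) (ℚ.*-inverseˡ r) ⟨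
    (1/ r *ℚ r) *ℚ x  ≡⟨ ℚ.*-assoc (1/ r) r x ⟩
    1/ r *ℚ (r *ℚ x)  ∎

-‿cancelˡ-≡ : ∀ r {p q} → r -ℚ p ≡ r -ℚ q → p ≡ q
-‿cancelˡ-≡ r {p} {q} e = begin
  p              ≡⟨ solve 2 (λ r p → p := r :- (r :- p)) refl r p ⟩
  r -ℚ (r -ℚ p)  ≡⟨ cong (r -ℚ_) e ⟩
  r -ℚ (r -ℚ q)  ≡⟨ solve 2 (λ r q → r :- (r :- q) := q) refl r q ⟩
  q              ∎
  where open ≡-Reasoning

p-q≡0⇒p≡q : ∀ p q → p -ℚ q ≡ 0ℚ → p ≡ q
p-q≡0⇒p≡q p q e = begin
  p              ≡⟨ solve 2 (λ p q → p := (p :- q) :+ q) refl p q ⟩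
  (p -ℚ q) +ℚ q  ≡⟨ cong (_+ℚ q) e ⟩
  0ℚ +ℚ q        ≡⟨ ℚ.+-identityˡ q ⟩
  q              ∎
  where open ≡-Reasoning

OnSegment-sym : ∀ p a b → OnSegment p a b → OnSegment p b a
OnSegment-sym (px , py) (ax , ay) (bx , by) (t , 0≤t , t≤1 , ex , ey) =
  1ℚ -ℚ t , p≤q⇒0≤q-p t≤1 , 1-t≤1 , trans ex (reverse ax bx) , trans ey (reverse ay by)
  where
  reverse : ∀ a b → a +ℚ t *ℚ (b -ℚ a) ≡ b +ℚ (1ℚ -ℚ t) *ℚ (a -ℚ b)
  reverse = solve 3 (λ t a b → a :+ t :* (b :- a) := b :+ (con 1ℚ :- t) :* (a :- b)) refl t
  1-t≤1 : 1ℚ -ℚ t ≤ℚ 1ℚ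
  1-t≤1 = subst (1ℚ -ℚ t ≤ℚ_) (solve 1 (λ t → (con 1ℚ :- t) :+ t := con 1ℚ) refl t)
    (p≤p+q (1ℚ -ℚ t) 0≤t)

SharedEndpoint : {V : Set} → (V → Point) → V → V → V → V → Point → Set
SharedEndpoint pos a b c d p = ∃ λ x → ((x ≡ a) ⊎ (x ≡ b)) × ((x ≡ c) ⊎ (x ≡ d)) × (p ≡ pos x)

SharedEndpoint-swap : ∀ {V : Set} {pos : V → Point} {a b c d p} →
  SharedEndpoint pos a b c d p → SharedEndpoint pos c d a b p
SharedEndpoint-swap (x , xab , xcd , p≡) = x , xcd , xab , p≡

-- Graphs on initial segments of ℕ

-- The first vertex of Fin (suc n) gets the newest label n, so dropping it leaves the graph on n.
label : ∀ {n} → Fin n → ℕ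
label {suc n} zero    = n
label {suc n} (suc i) = label i

label<n : ∀ {n} (i : Fin n) → label i < n
label<n {suc n} zero    = ≤-refl
label<n {suc n} (suc i) = m≤n⇒m≤1+n (label<n i)

label-injective : ∀ {n} → Injective _≡_ _≡_ (label {n})
label-injective {suc n} {zero}  {zero}  _ = refl
label-injective {suc n} {zero}  {suc j} e = ⊥-elim (<-irrefl (sym e) (label<n j))
label-injective {suc n} {suc i} {zero}  e = ⊥-elim (<-irrefl e (label<n i))
label-injective {suc n} {suc i} {suc j} e = cong suc (label-injective e)

count-label : (h : ℕ → Bool) (n : ℕ) → count (h ∘ label) (allFin n) ≡ countBelow h n
count-label h zero    = refl
count-label h (suc n) = trans (count-allFin-suc (h ∘ label)) (cong (indicator (h n) +_) (count-label h n))

record StraightLineDrawing (A : ℕ → ℕ → Bool) : Set where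
  field
    position           : ℕ → Point
    position-injective : Injective _≡_ _≡_ position
    vertex-off-edges   : ∀ w u v → A u v ≡ true →
      OnSegment (position w) (position u) (position v) → (w ≡ u) ⊎ (w ≡ v)
    edges-noncrossing  : ∀ a b c d → A a b ≡ true → A c d ≡ true →
      ¬ ((a ≡ c) × (b ≡ d)) → ¬ ((a ≡ d) × (b ≡ c)) →
      ∀ p → OnSegment p (position a) (position b) → OnSegment p (position c) (position d) →
      SharedEndpoint position a b c d p

symmetrise : (ℕ → ℕ → Bool) → ℕ → ℕ → Bool
symmetrise E u v = E u v ∨ E v u

oriented-drawing : (E : ℕ → ℕ → Bool) (position : ℕ → Point) → Injective _≡_ _≡_ position →
  (∀ w u v → E u v ≡ true → OnSegment (position w) (position u) (position v) → (w ≡ u) ⊎ (w ≡ v)) →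
  (∀ a b c d → E a b ≡ true → E c d ≡ true → ¬ ((a ≡ c) × (b ≡ d)) →
    ∀ p → OnSegment p (position a) (position b) → OnSegment p (position c) (position d) →
    SharedEndpoint position a b c d p) →
  StraightLineDrawing (symmetrise E)
oriented-drawing E position position-injective off-edges noncrossing = record
  { position           = position
  ; position-injective = position-injective
  ; vertex-off-edges   = vertex-off-edges
  ; edges-noncrossing  = edges-noncrossing
  }
  where
  flip : ∀ {p a b} → OnSegment p (position a) (position b) → OnSegment p (position b) (position a)
  flip {p} {a} {b} = OnSegment-sym p (position a) (position b)

  swapˡ : ∀ {a b c d p} → SharedEndpoint position b a c d p → SharedEndpoint position a b c d p
  swapˡ (x , xba , xcd , p≡) = x , swap⊎ xba , xcd , p≡

  swapʳ : ∀ {a b c d p} → SharedEndpoint position a b d c p → SharedEndpoint position a b c d p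
  swapʳ (x , xab , xdc , p≡) = x , xab , swap⊎ xdc , p≡

  vertex-off-edges : ∀ w u v → symmetrise E u v ≡ true →
    OnSegment (position w) (position u) (position v) → (w ≡ u) ⊎ (w ≡ v)
  vertex-off-edges w u v uv s with ∨-true uv
  ... | inj₁ Euv = off-edges w u v Euv s
  ... | inj₂ Evu = swap⊎ (off-edges w v u Evu (flip s))

  edges-noncrossing : ∀ a b c d → symmetrise E a b ≡ true → symmetrise E c d ≡ true →
    ¬ ((a ≡ c) × (b ≡ d)) → ¬ ((a ≡ d) × (b ≡ c)) →
    ∀ p → OnSegment p (position a) (position b) → OnSegment p (position c) (position d) →
    SharedEndpoint position a b c d p
  edges-noncrossing a b c d ab cd ne ne′ p s s′ with ∨-true ab | ∨-true cd
  ... | inj₁ Eab | inj₁ Ecd = noncrossing a b c d Eab Ecd ne p s s′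
  ... | inj₁ Eab | inj₂ Edc = swapʳ (noncrossing a b d c Eab Edc ne′ p s (flip s′))
  ... | inj₂ Eba | inj₁ Ecd = swapˡ (noncrossing b a c d Eba Ecd (ne′ ∘ swap×) p (flip s) s′)
  ... | inj₂ Eba | inj₂ Edc = swapˡ (swapʳ (noncrossing b a d c Eba Edc (ne ∘ swap×) p (flip s) (flip s′)))

module Restriction (A : ℕ → ℕ → Bool) (A-sym : ∀ u v → A u v ≡ A v u) (A-irrefl : ∀ u → A u u ≡ false)
  where

  restrict : (n : ℕ) → Graph n
  restrict n = record
    { adj    = λ i j → A (label i) (label j)
    ; sym    = λ i j → A-sym (label i) (label j)
    ; irrefl = A-irrefl ∘ label
    }

  edgeCount-restrict-suc : ∀ n →
    edgeCount (restrict (suc n)) ≡ countBelow (A n) n + edgeCount (restrict n)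
  edgeCount-restrict-suc n = begin
    edgeCount (restrict (suc n))                                       ≡⟨ edgeCount-rows (suc n) ⟩
    sum (map (rowCount (suc n)) (allFin (suc n)))                      ≡⟨ sum-allFin-suc (rowCount (suc n)) ⟩
    rowCount (suc n) zero + sum (map (rowCount (suc n) ∘ suc) (allFin n))
      ≡⟨ cong₂ _+_ (count-allFin-suc (rowPred {suc n} zero))
                   (cong sum (map-cong (λ i → count-allFin-suc (rowPred (suc i))) (allFin n))) ⟩
    count (A n ∘ label) (allFin n) + sum (map (rowCount n) (allFin n))
      ≡⟨ cong₂ _+_ (count-label (A n) n) (sym (edgeCount-rows n)) ⟩
    countBelow (A n) n + edgeCount (restrict n)                        ∎
    where
    open ≡-Reasoning
    rowPred : ∀ {m} → Fin m → Fin m → Bool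
    rowPred i j = (toℕ i <ᵇ toℕ j) ∧ A (label i) (label j)
    rowCount : (m : ℕ) → Fin m → ℕ
    rowCount m i = count (rowPred i) (allFin m)
    edgeCount-rows : ∀ m → edgeCount (restrict m) ≡ sum (map (rowCount m) (allFin m))
    edgeCount-rows m = trans (count-concatMap _ (λ i → map (i ,_) (allFin m)) (allFin m))
      (cong sum (map-cong (λ i → count-map _ (i ,_) (allFin m)) (allFin m)))

  IsClique : ∀ {n} → Vec Bool n → Set
  IsClique {n} S =
    (i j : Fin n) → lookup S i ≡ true → lookup S j ≡ true → i ≢ j → A (label i) (label j) ≡ true

  Within : ∀ {n} → (ℕ → Bool) → Vec Bool n → Set
  Within P S = ∀ i → lookup S i ≡ true → P (label i) ≡ true

  withinᵇ : ∀ {n} → (ℕ → Bool) → Vec Bool n → Bool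
  withinᵇ {n} P S = allᵇ (λ i → not (lookup S i) ∨ P (label i)) (allFin n)

  isClique-sound : ∀ {n} (S : Vec Bool n) → isCliqueᵇ (restrict n) S ≡ true → IsClique S
  isClique-sound S e i j si sj i≢j
    with i ≟ j | implication-sound (allᵇ-allFin _ (allᵇ-allFin _ e i) j) (∧-intro si sj)
  ... | yes i≡j | _ = ⊥-elim (i≢j i≡j)
  ... | no _    | c = c

  isClique-complete : ∀ {n} (S : Vec Bool n) → IsClique S → isCliqueᵇ (restrict n) S ≡ true
  isClique-complete {n} S c = allᵇ-complete _ (allFin n) λ i → allᵇ-complete _ (allFin n) λ j →
    implication-complete λ sij → adjacent-or-equal i j (∧-true sij)
    where
    adjacent-or-equal : ∀ i j → lookup S i ≡ true × lookup S j ≡ true →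
      does (i ≟ j) ∨ A (label i) (label j) ≡ true
    adjacent-or-equal i j (si , sj) with i ≟ j
    ... | yes _   = refl
    ... | no i≢j  = c i j si sj i≢j

  within-sound : ∀ {n} P (S : Vec Bool n) → withinᵇ P S ≡ true → Within P S
  within-sound P S e i = implication-sound (allᵇ-allFin _ e i)

  within-complete : ∀ {n} P (S : Vec Bool n) → Within P S → withinᵇ P S ≡ true
  within-complete {n} P S w = allᵇ-complete _ (allFin n) λ i → implication-complete (w i)

  CliqueWithin : ∀ {n} → (ℕ → Bool) → Vec Bool n → Set
  CliqueWithin P S = IsClique S × Within P S

  cliqueWithinᵇ : ∀ {n} → (ℕ → Bool) → Vec Bool n → Bool
  cliqueWithinᵇ {n} P S = isCliqueᵇ (restrict n) S ∧ withinᵇ P S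

  cliqueWithin-sound : ∀ {n} P (S : Vec Bool n) → cliqueWithinᵇ P S ≡ true → CliqueWithin P S
  cliqueWithin-sound P S e = isClique-sound S (proj₁ (∧-true e)) , within-sound P S (proj₂ (∧-true e))

  cliqueWithin-complete : ∀ {n} P (S : Vec Bool n) → CliqueWithin P S → cliqueWithinᵇ P S ≡ true
  cliqueWithin-complete P S (c , w) = ∧-intro (isClique-complete S c) (within-complete P S w)

  cliqueWithin-tail : ∀ {n} P {b} {S : Vec Bool n} → CliqueWithin P (b ∷ S) → CliqueWithin P S
  cliqueWithin-tail P (c , w) = (λ i j si sj i≢j → c (suc i) (suc j) si sj (i≢j ∘ suc-injective)) , w ∘ suc

  cliqueWithin-false : ∀ {n} P {S : Vec Bool n} → CliqueWithin P S → CliqueWithin P (false ∷ S)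
  cliqueWithin-false P {S} (c , w) = clique , within
    where
    clique : IsClique (false ∷ S)
    clique zero    _       ()
    clique (suc i) zero    _  ()
    clique (suc i) (suc j) si sj i≢j = c i j si sj (i≢j ∘ cong suc)
    within : Within P (false ∷ S)
    within zero    ()
    within (suc i) = w i

  cliqueWithin-true⁻ : ∀ {n} P {S : Vec Bool n} →
    CliqueWithin P (true ∷ S) → P n ≡ true × CliqueWithin (P ∩ A n) S
  cliqueWithin-true⁻ P cw@(c , w) =
    w zero refl , proj₁ (cliqueWithin-tail P cw) ,
    λ i si → ∧-intro (w (suc i) si) (c zero (suc i) refl si λ ())

  cliqueWithin-true⁺ : ∀ {n} P {S : Vec Bool n} →
    P n ≡ true → CliqueWithin (P ∩ A n) S → CliqueWithin P (true ∷ S)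
  cliqueWithin-true⁺ {n} P {S} pn (c , w) = clique , within
    where
    clique : IsClique (true ∷ S)
    clique zero    zero    _  _  0≢0 = ⊥-elim (0≢0 refl)
    clique zero    (suc j) _  sj _   = proj₂ (∧-true (w j sj))
    clique (suc i) zero    si _  _   = trans (A-sym (label i) n) (proj₂ (∧-true (w i si)))
    clique (suc i) (suc j) si sj i≢j = c i j si sj (i≢j ∘ cong suc)
    within : Within P (true ∷ S)
    within zero    _  = pn
    within (suc i) si = proj₁ (∧-true (w i si))

  cliqueWithinᵇ-false : ∀ {n} P (S : Vec Bool n) → cliqueWithinᵇ P (false ∷ S) ≡ cliqueWithinᵇ P S
  cliqueWithinᵇ-false P S = bool-extensionality
    (cliqueWithin-complete P S ∘ cliqueWithin-tail P ∘ cliqueWithin-sound P (false ∷ S))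
    (cliqueWithin-complete P (false ∷ S) ∘ cliqueWithin-false P ∘ cliqueWithin-sound P S)

  cliqueWithinᵇ-true : ∀ {n} P (S : Vec Bool n) →
    cliqueWithinᵇ P (true ∷ S) ≡ P n ∧ cliqueWithinᵇ (P ∩ A n) S
  cliqueWithinᵇ-true {n} P S = bool-extensionality
    (λ e → let (pn , cw) = cliqueWithin-true⁻ P (cliqueWithin-sound P (true ∷ S) e)
           in ∧-intro pn (cliqueWithin-complete (P ∩ A n) S cw))
    (λ e → let (pn , e′) = ∧-true e
           in cliqueWithin-complete P (true ∷ S)
                (cliqueWithin-true⁺ P pn (cliqueWithin-sound (P ∩ A n) S e′)))

  cliquesWithin : ℕ → (ℕ → Bool) → ℕ
  cliquesWithin zero    P = 1
  cliquesWithin (suc n) P = cliquesWithin n P + (if P n then cliquesWithin n (P ∩ A n) else 0)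

  count-cliqueWithin : ∀ n P → count (cliqueWithinᵇ P) (allSubsets n) ≡ cliquesWithin n P
  count-cliqueWithin zero    P = refl
  count-cliqueWithin (suc n) P = begin
    count (cliqueWithinᵇ P) (map (true ∷_) subsets ++ map (false ∷_) subsets)
      ≡⟨ count-++ _ (map (true ∷_) subsets) _ ⟩
    count (cliqueWithinᵇ P) (map (true ∷_) subsets) + count (cliqueWithinᵇ P) (map (false ∷_) subsets)
      ≡⟨ cong₂ _+_ (trans (count-map _ _ subsets) (count-cong (cliqueWithinᵇ-true P) subsets))
                   (trans (count-map _ _ subsets) (count-cong (cliqueWithinᵇ-false P) subsets)) ⟩
    count (λ S → P n ∧ cliqueWithinᵇ (P ∩ A n) S) subsets + count (cliqueWithinᵇ P) subsets
      ≡⟨ cong₂ _+_ (count-∧ (P n) subsets) (count-cliqueWithin n P) ⟩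
    (if P n then count (cliqueWithinᵇ (P ∩ A n)) subsets else 0) + cliquesWithin n P
      ≡⟨ cong (λ c → (if P n then c else 0) + cliquesWithin n P) (count-cliqueWithin n (P ∩ A n)) ⟩
    (if P n then cliquesWithin n (P ∩ A n) else 0) + cliquesWithin n P
      ≡⟨ +-comm _ (cliquesWithin n P) ⟩
    cliquesWithin (suc n) P ∎
    where
    open ≡-Reasoning
    subsets = allSubsets n

  cliqueCount-restrict : ∀ n → cliqueCount (restrict n) ≡ cliquesWithin n (λ _ → true)
  cliqueCount-restrict n = trans (count-cong withinAll (allSubsets n)) (count-cliqueWithin n (λ _ → true))
    where
    withinAll : ∀ S → isCliqueᵇ (restrict n) S ≡ cliqueWithinᵇ (λ _ → true) S
    withinAll S =
      sym (trans (cong (isCliqueᵇ (restrict n) S ∧_) (within-complete _ S λ _ _ → refl)) (∧-identityʳ _))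

  cliquesWithin-cong : ∀ n {P Q} → (∀ x → x < n → P x ≡ Q x) → cliquesWithin n P ≡ cliquesWithin n Q
  cliquesWithin-cong zero    e = refl
  cliquesWithin-cong (suc n) {P} {Q} e rewrite e n ≤-refl =
    cong₂ _+_ (cliquesWithin-cong n e′)
              (cong (λ c → if Q n then c else 0) (cliquesWithin-cong n λ x x<n → cong (_∧ A n x) (e′ x x<n)))
    where
    e′ : ∀ x → x < n → P x ≡ Q x
    e′ x x<n = e x (m≤n⇒m≤1+n x<n)

  cliquesWithin-skip : ∀ m d {P} → (∀ x → m ≤ x → x < d + m → P x ≡ false) →
    cliquesWithin (d + m) P ≡ cliquesWithin m P
  cliquesWithin-skip m zero    e = refl
  cliquesWithin-skip m (suc d) e rewrite e (d + m) (m≤n+m m d) ≤-refl =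
    trans (+-identityʳ _) (cliquesWithin-skip m d λ x m≤x x<d+m → e x m≤x (m≤n⇒m≤1+n x<d+m))

  cliquesWithin-empty : ∀ n {P} → (∀ x → x < n → P x ≡ false) → cliquesWithin n P ≡ 1
  cliquesWithin-empty zero    e = refl
  cliquesWithin-empty (suc n) e rewrite e n ≤-refl =
    trans (+-identityʳ _) (cliquesWithin-empty n λ x x<n → e x (m≤n⇒m≤1+n x<n))

  restrict-planar : StraightLineDrawing A → ∀ n → Planar (restrict n)
  restrict-planar D n = record
    { pos                = position ∘ label
    ; pos-injective      = λ e → label-injective (position-injective e)
    ; vertex-off-edges   = λ w u v uv s → map⊎ label-injective label-injective
                                            (vertex-off-edges (label w) (label u) (label v) uv s)
    ; edges-noncrossing  = λ a b c d ab cd ne ne′ p s s′ → shared-endpoint-label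
                             (edges-noncrossing (label a) (label b) (label c) (label d) ab cd
                               (ne ∘ map× label-injective label-injective)
                               (ne′ ∘ map× label-injective label-injective) p s s′)
    }
    where
    open StraightLineDrawing D
    shared-endpoint-label : ∀ {a b c d : Fin n} {p} →
      SharedEndpoint position (label a) (label b) (label c) (label d) p → SharedEndpoint (position ∘ label) a b c d p
    shared-endpoint-label {a}     (_ , inj₁ refl , xcd , p≡) = a , inj₁ refl , map⊎ label-injective label-injective xcd , p≡
    shared-endpoint-label {b = b} (_ , inj₂ refl , xcd , p≡) = b , inj₂ refl , map⊎ label-injective label-injective xcd , p≡

-- The double fan

previousOrHub : ℕ → ℕ → Bool
previousOrHub _       0             = true
previousOrHub _       1             = true
previousOrHub zero    (suc (suc _)) = false
previousOrHub (suc j) (suc (suc w)) = does (w ≟ℕ j)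

-- Vertices 0 and 1 are the hubs, 2 + j for j < k the rim and the labels from 2 + k on are
-- isolated; every edge is listed once, at its larger end.
fanEdge : ℕ → ℕ → ℕ → Bool
fanEdge k 0             _       = false
fanEdge k 1             0       = true
fanEdge k 1             (suc _) = false
fanEdge k (suc (suc j)) v       = does (j <? k) ∧ previousOrHub j v

fanAdj : ℕ → ℕ → ℕ → Bool
fanAdj k = symmetrise (fanEdge k)

previousOrHub-bound : ∀ j v → previousOrHub j v ≡ true → v < 2 + j
previousOrHub-bound j       0             _ = s≤s z≤n
previousOrHub-bound j       1             _ = s≤s (s≤s z≤n)
previousOrHub-bound (suc j) (suc (suc w)) e rewrite dec-true⁻¹ (w ≟ℕ j) e = ≤-refl

previousOrHub-gap : ∀ j x → 2 ≤ x → x < j + 2 → previousOrHub (suc j) x ≡ false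
previousOrHub-gap j 1             (s≤s ()) _
previousOrHub-gap j (suc (suc w)) _        x<j+2 =
  dec-false (w ≟ℕ j) (<⇒≢ (≤-pred (≤-pred (subst (3 + w ≤_) (+-comm j 2) x<j+2))))

fanEdge-descending : ∀ k u v → fanEdge k u v ≡ true → v < u
fanEdge-descending k 1             0 _ = s≤s z≤n
fanEdge-descending k (suc (suc j)) v e = previousOrHub-bound j v (proj₂ (∧-true {does (j <? k)} e))

fanEdge-irrefl : ∀ k u → fanEdge k u u ≡ false
fanEdge-irrefl k u with fanEdge k u u in e
... | false = refl
... | true  = ⊥-elim (<-irrefl refl (fanEdge-descending k u u e))

fanAdj-sym : ∀ k u v → fanAdj k u v ≡ fanAdj k v u
fanAdj-sym k u v = ∨-comm (fanEdge k u v) (fanEdge k v u)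

fanAdj-irrefl : ∀ k u → fanAdj k u u ≡ false
fanAdj-irrefl k u = cong₂ _∨_ (fanEdge-irrefl k u) (fanEdge-irrefl k u)

fanAdj-below : ∀ k {u v} → v < u → fanAdj k u v ≡ fanEdge k u v
fanAdj-below k {u} {v} v<u with fanEdge k v u in e
... | false = ∨-identityʳ _
... | true  = ⊥-elim (<-asym v<u (fanEdge-descending k v u e))

-- Kept opaque: unfolding fromℕ on open terms makes the typechecker normalise rational arithmetic,
-- which is prohibitively slow.
opaque
  fromℕ : ℕ → ℚ
  fromℕ zero    = 0ℚ
  fromℕ (suc n) = 1ℚ +ℚ fromℕ n

  fromℕ-zero : fromℕ 0 ≡ 0ℚ
  fromℕ-zero = refl

  fromℕ-suc : ∀ n → fromℕ (suc n) ≡ 1ℚ +ℚ fromℕ n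
  fromℕ-suc n = refl

fromℕ-nonNeg : ∀ n → 0ℚ ≤ℚ fromℕ n
fromℕ-nonNeg zero    = ℚ.≤-reflexive (sym fromℕ-zero)
fromℕ-nonNeg (suc n) = subst (0ℚ ≤ℚ_) (sym (fromℕ-suc n)) (ℚ.+-mono-≤ 0≤1 (fromℕ-nonNeg n))

1≤fromℕ-suc : ∀ n → 1ℚ ≤ℚ fromℕ (suc n)
1≤fromℕ-suc n = subst (1ℚ ≤ℚ_) (sym (fromℕ-suc n)) (p≤p+q 1ℚ (fromℕ-nonNeg n))

fromℕ-suc≢0 : ∀ n → fromℕ (suc n) ≢ 0ℚ
fromℕ-suc≢0 n e = 1≰0 (subst (1ℚ ≤ℚ_) e (1≤fromℕ-suc n))

fromℕ-cancel-≤ : ∀ m n → fromℕ m ≤ℚ fromℕ n → m ≤ n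
fromℕ-cancel-≤ zero    n       _  = z≤n
fromℕ-cancel-≤ (suc m) zero    le =
  ⊥-elim (1≰0 (ℚ.≤-trans (1≤fromℕ-suc m) (subst (fromℕ (suc m) ≤ℚ_) fromℕ-zero le)))
fromℕ-cancel-≤ (suc m) (suc n) le =
  s≤s (fromℕ-cancel-≤ m n (+-cancelˡ-≤ 1ℚ (subst₂ _≤ℚ_ (fromℕ-suc m) (fromℕ-suc n) le)))

fromℕ-injective : ∀ {m n} → fromℕ m ≡ fromℕ n → m ≡ n
fromℕ-injective {m} {n} e =
  ≤-antisym (fromℕ-cancel-≤ m n (ℚ.≤-reflexive e)) (fromℕ-cancel-≤ n m (ℚ.≤-reflexive (sym e)))

fromℕ+≤fromℕ-suc : ∀ n {t} → t ≤ℚ 1ℚ → fromℕ n +ℚ t ≤ℚ fromℕ (suc n)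
fromℕ+≤fromℕ-suc n {t} t≤1 =
  subst (fromℕ n +ℚ t ≤ℚ_) (trans (ℚ.+-comm (fromℕ n) 1ℚ) (sym (fromℕ-suc n)))
    (ℚ.+-monoʳ-≤ (fromℕ n) t≤1)

fromℕ-within-unit : ∀ m n {t} → fromℕ m ≡ fromℕ n +ℚ t → 0ℚ ≤ℚ t → t ≤ℚ 1ℚ → m ≡ n ⊎ m ≡ suc n
fromℕ-within-unit m n e 0≤t t≤1
  with m≤n⇒m<n∨m≡n (fromℕ-cancel-≤ m (suc n) (subst (_≤ℚ _) (sym e) (fromℕ+≤fromℕ-suc n t≤1)))
... | inj₂ m≡1+n     = inj₂ m≡1+n
... | inj₁ (s≤s m≤n) =
  inj₁ (≤-antisym m≤n (fromℕ-cancel-≤ n m (subst (_ ≤ℚ_) (sym e) (p≤p+q (fromℕ n) 0≤t))))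

fromℕ-unit-overlap : ∀ m n {s t} → fromℕ m +ℚ s ≡ fromℕ n +ℚ t → s ≤ℚ 1ℚ → 0ℚ ≤ℚ t → m < n →
  n ≡ suc m × t ≡ 0ℚ
fromℕ-unit-overlap m n {s} {t} e s≤1 0≤t m<n = n≡1+m , ℚ.≤-antisym t≤0 0≤t
  where
  n+t≤1+m : fromℕ n +ℚ t ≤ℚ fromℕ (suc m)
  n+t≤1+m = subst (_≤ℚ _) e (fromℕ+≤fromℕ-suc m s≤1)
  n≡1+m : n ≡ suc m
  n≡1+m = ≤-antisym (fromℕ-cancel-≤ n (suc m) (ℚ.≤-trans (p≤p+q (fromℕ n) 0≤t) n+t≤1+m)) m<n
  t≤0 : t ≤ℚ 0ℚ
  t≤0 = +-cancelˡ-≤ (fromℕ n)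
    (subst (_ ≤ℚ_) (trans (cong fromℕ (sym n≡1+m)) (sym (ℚ.+-identityʳ (fromℕ n)))) n+t≤1+m)

data Hub : Set where
  top bottom : Hub

hub : Hub → ℕ
hub top    = 0
hub bottom = 1

height : Hub → ℚ
height top    = 1ℚ
height bottom = - 1ℚ

height≢0 : ∀ h → height h ≢ 0ℚ
height≢0 top    = from-no (1ℚ ℚ.≟ 0ℚ)
height≢0 bottom = from-no (- 1ℚ ℚ.≟ 0ℚ)

position : ℕ → Point
position 0             = 0ℚ , 1ℚ
position 1             = 0ℚ , - 1ℚ
position (suc (suc r)) = fromℕ (2 + r) , 0ℚ

position-hub : ∀ h → position (hub h) ≡ (0ℚ , height h)
position-hub top    = refl
position-hub bottom = refl

position-injective : ∀ {u v} → position u ≡ position v → u ≡ v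
position-injective {0}           {0}           _ = refl
position-injective {0}           {1}           e = ⊥-elim (from-no (1ℚ ℚ.≟ - 1ℚ) (cong proj₂ e))
position-injective {0}           {suc (suc _)} e = ⊥-elim (height≢0 top (cong proj₂ e))
position-injective {1}           {0}           e = ⊥-elim (from-no (1ℚ ℚ.≟ - 1ℚ) (sym (cong proj₂ e)))
position-injective {1}           {1}           _ = refl
position-injective {1}           {suc (suc _)} e = ⊥-elim (height≢0 bottom (cong proj₂ e))
position-injective {suc (suc _)} {0}           e = ⊥-elim (height≢0 top (sym (cong proj₂ e)))
position-injective {suc (suc _)} {1}           e = ⊥-elim (height≢0 bottom (sym (cong proj₂ e)))
position-injective {suc (suc _)} {suc (suc _)} e = fromℕ-injective (cong proj₁ e)

data Edge : ℕ → ℕ → Set where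
  axle  : Edge 1 0
  spoke : ∀ h r → Edge (2 + r) (hub h)
  rim   : ∀ j → Edge (3 + j) (2 + j)

OnEdge : ∀ {u v} → Edge u v → Point → Set
OnEdge axle        (x , _) = x ≡ 0ℚ
OnEdge (spoke h r) (x , y) =
  ∃ λ t → 0ℚ ≤ℚ t × t ≤ℚ 1ℚ × x ≡ t *ℚ fromℕ (2 + r) × y ≡ height h *ℚ (1ℚ -ℚ t)
OnEdge (rim j)     (x , y) =
  ∃ λ t → 0ℚ ≤ℚ t × t ≤ℚ 1ℚ × x ≡ fromℕ (2 + j) +ℚ t × y ≡ 0ℚ

edge-locus : ∀ {u v} (e : Edge u v) p → OnSegment p (position u) (position v) → OnEdge e p
edge-locus axle (x , y) (t , _ , _ , ex , _) =
  trans ex (solve 1 (λ t → con 0ℚ :+ t :* (con 0ℚ :- con 0ℚ) := con 0ℚ) refl t)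
edge-locus (spoke h r) p s = spoke-locus p
  (subst (λ q → OnSegment p q (position (2 + r))) (position-hub h)
    (OnSegment-sym p (position (2 + r)) (position (hub h)) s))
  where
  spoke-locus : ∀ p → OnSegment p (0ℚ , height h) (fromℕ (2 + r) , 0ℚ) → OnEdge (spoke h r) p
  spoke-locus (x , y) (t , 0≤t , t≤1 , ex , ey) = t , 0≤t , t≤1 ,
    trans ex (solve 2 (λ t R → con 0ℚ :+ t :* (R :- con 0ℚ) := t :* R) refl t (fromℕ (2 + r))) ,
    trans ey (solve 2 (λ t σ → σ :+ t :* (con 0ℚ :- σ) := σ :* (con 1ℚ :- t)) refl t (height h))
edge-locus (rim j) p s = rim-locus p (OnSegment-sym p (position (3 + j)) (position (2 + j)) s)
  where
  J = fromℕ (2 + j)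
  rim-locus : ∀ p → OnSegment p (J , 0ℚ) (fromℕ (3 + j) , 0ℚ) → OnEdge (rim j) p
  rim-locus (x , y) (t , 0≤t , t≤1 , ex , ey) = t , 0≤t , t≤1 ,
    trans ex (trans (cong (λ K → J +ℚ t *ℚ (K -ℚ J)) (fromℕ-suc (2 + j)))
      (solve 2 (λ t J → J :+ t :* ((con 1ℚ :+ J) :- J) := J :+ t) refl t J)) ,
    trans ey (solve 1 (λ t → con 0ℚ :+ t :* (con 0ℚ :- con 0ℚ) := con 0ℚ) refl t)

spoke-on-y-axis : ∀ {h r x y} → OnEdge (spoke h r) (x , y) → x ≡ 0ℚ → (x , y) ≡ position (hub h)
spoke-on-y-axis {h} {r} {x} {y} (t , _ , _ , ex , ey) x≡0 =
  trans (cong₂ _,_ x≡0 y≡height) (sym (position-hub h))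
  where
  t≡0 : t ≡ 0ℚ
  t≡0 = *-cancelˡ-≡ (fromℕ (2 + r)) (fromℕ-suc≢0 (1 + r))
    (trans (ℚ.*-comm (fromℕ (2 + r)) t) (trans (sym ex) (trans x≡0 (sym (ℚ.*-zeroʳ (fromℕ (2 + r)))))))
  y≡height : y ≡ height h
  y≡height = trans ey (trans (cong (λ t → height h *ℚ (1ℚ -ℚ t)) t≡0)
    (solve 1 (λ σ → σ :* (con 1ℚ :- con 0ℚ) := σ) refl (height h)))

spoke-on-x-axis : ∀ {h r x y} → OnEdge (spoke h r) (x , y) → y ≡ 0ℚ → (x , y) ≡ position (2 + r)
spoke-on-x-axis {h} {r} {x} {y} (t , _ , _ , ex , ey) y≡0 = cong₂ _,_ x≡rim y≡0
  where
  1-t≡0 : 1ℚ -ℚ t ≡ 0ℚ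
  1-t≡0 = *-cancelˡ-≡ (height h) (height≢0 h) (trans (sym ey) (trans y≡0 (sym (ℚ.*-zeroʳ (height h)))))
  x≡rim : x ≡ fromℕ (2 + r)
  x≡rim = trans ex (trans (cong (_*ℚ fromℕ (2 + r)) (sym (p-q≡0⇒p≡q 1ℚ t 1-t≡0)))
    (ℚ.*-identityˡ (fromℕ (2 + r))))

rim-start : ∀ {j x y} → (l : OnEdge (rim j) (x , y)) → proj₁ l ≡ 0ℚ → (x , y) ≡ position (2 + j)
rim-start {j} (t , _ , _ , ex , ey) t≡0 =
  cong₂ _,_ (trans ex (trans (cong (fromℕ (2 + j) +ℚ_) t≡0) (ℚ.+-identityʳ (fromℕ (2 + j))))) ey

rim-off-y-axis : ∀ {j x y} → OnEdge (rim j) (x , y) → x ≢ 0ℚ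
rim-off-y-axis {j} (t , 0≤t , _ , ex , _) x≡0 =
  1≰0 (ℚ.≤-trans (1≤fromℕ-suc (1 + j))
    (ℚ.≤-trans (p≤p+q (fromℕ (2 + j)) 0≤t) (ℚ.≤-reflexive (trans (sym ex) x≡0))))

rim-vertex : ∀ {j} w → OnEdge (rim j) (position w) → w ≡ 3 + j ⊎ w ≡ 2 + j
rim-vertex     0             (_ , _ , _ , _ , ey)     = ⊥-elim (height≢0 top ey)
rim-vertex     1             (_ , _ , _ , _ , ey)     = ⊥-elim (height≢0 bottom ey)
rim-vertex {j} (suc (suc w)) (t , 0≤t , t≤1 , ex , _) = swap⊎ (fromℕ-within-unit (2 + w) (2 + j) ex 0≤t t≤1)

vertex-on-edge : ∀ {u v} (e : Edge u v) w → OnEdge e (position w) → w ≡ u ⊎ w ≡ v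
vertex-on-edge axle        0             _   = inj₂ refl
vertex-on-edge axle        1             _   = inj₁ refl
vertex-on-edge axle        (suc (suc w)) x≡0 = ⊥-elim (fromℕ-suc≢0 (1 + w) x≡0)
vertex-on-edge (spoke h r) 0             l   = inj₂ (position-injective (spoke-on-y-axis {h} l refl))
vertex-on-edge (spoke h r) 1             l   = inj₂ (position-injective (spoke-on-y-axis {h} l refl))
vertex-on-edge (spoke h r) (suc (suc w)) l   = inj₁ (position-injective (spoke-on-x-axis {h} l refl))
vertex-on-edge (rim j)     w             l   = rim-vertex w l

hub-on-axle : ∀ h → hub h ≡ 1 ⊎ hub h ≡ 0
hub-on-axle top    = inj₂ refl
hub-on-axle bottom = inj₁ refl

axle-spoke-cross : ∀ h r p → OnEdge axle p → OnEdge (spoke h r) p →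
  SharedEndpoint position 1 0 (2 + r) (hub h) p
axle-spoke-cross h r (x , y) x≡0 l = hub h , hub-on-axle h , inj₂ refl , spoke-on-y-axis {h} l x≡0

spoke-rim-cross : ∀ h r j p → OnEdge (spoke h r) p → OnEdge (rim j) p →
  SharedEndpoint position (2 + r) (hub h) (3 + j) (2 + j) p
spoke-rim-cross h r j (x , y) l l′@(_ , _ , _ , _ , y≡0) =
  2 + r , inj₁ refl , rim-vertex (2 + r) (subst (OnEdge (rim j)) on-rim l′) , on-rim
  where
  on-rim : (x , y) ≡ position (2 + r)
  on-rim = spoke-on-x-axis {h} l y≡0

spokes-same-hub : ∀ h {r r′} → r ≢ r′ → ∀ p → OnEdge (spoke h r) p → OnEdge (spoke h r′) p →
  p ≡ position (hub h)
spokes-same-hub h {r} {r′} r≢r′ (x , y) l@(t , _ , _ , ex , ey) (s , _ , _ , ex′ , ey′) with t ℚ.≟ 0ℚ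
... | yes t≡0 = spoke-on-y-axis {h} l
                  (trans ex (trans (cong (_*ℚ fromℕ (2 + r)) t≡0) (ℚ.*-zeroˡ (fromℕ (2 + r)))))
... | no t≢0  = ⊥-elim (r≢r′ (cong (_∸ 2) (fromℕ-injective (*-cancelˡ-≡ t t≢0
                  (trans (sym ex) (trans ex′ (cong (_*ℚ fromℕ (2 + r′)) (sym t≡s))))))))
  where
  t≡s : t ≡ s
  t≡s = -‿cancelˡ-≡ 1ℚ (*-cancelˡ-≡ (height h) (height≢0 h) (trans (sym ey) ey′))

spokes-opposite : ∀ {r r′ x y} → OnEdge (spoke top r) (x , y) → OnEdge (spoke bottom r′) (x , y) → y ≡ 0ℚ
spokes-opposite {y = y} (t , _ , t≤1 , _ , ey) (s , _ , s≤1 , _ , ey′) =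
  trans ey (trans (cong (1ℚ *ℚ_) 1-t≡0) (ℚ.*-zeroʳ 1ℚ))
  where
  sum≡0 : (1ℚ -ℚ t) +ℚ (1ℚ -ℚ s) ≡ 0ℚ
  sum≡0 = begin
    (1ℚ -ℚ t) +ℚ (1ℚ -ℚ s)
      ≡⟨ solve 2 (λ t s → (con 1ℚ :- t) :+ (con 1ℚ :- s)
                          := con 1ℚ :* (con 1ℚ :- t) :- con (- 1ℚ) :* (con 1ℚ :- s)) refl t s ⟩
    1ℚ *ℚ (1ℚ -ℚ t) -ℚ (- 1ℚ) *ℚ (1ℚ -ℚ s)  ≡⟨ cong₂ _-ℚ_ ey ey′ ⟨
    y -ℚ y                                   ≡⟨ ℚ.+-inverseʳ y ⟩
    0ℚ                                       ∎
    where open ≡-Reasoning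
  1-t≡0 : 1ℚ -ℚ t ≡ 0ℚ
  1-t≡0 = nonNeg+nonNeg≡0 (p≤q⇒0≤q-p t≤1) (p≤q⇒0≤q-p s≤1) sum≡0

opposite-spokes-cross : ∀ r r′ p → OnEdge (spoke top r) p → OnEdge (spoke bottom r′) p →
  SharedEndpoint position (2 + r) (hub top) (2 + r′) (hub bottom) p
opposite-spokes-cross r r′ (x , y) l l′ =
  2 + r , inj₁ refl , inj₁ (position-injective (trans (sym on-rim) on-rim′)) , on-rim
  where
  on-rim : (x , y) ≡ position (2 + r)
  on-rim = spoke-on-x-axis {top} l (spokes-opposite l l′)
  on-rim′ : (x , y) ≡ position (2 + r′)
  on-rim′ = spoke-on-x-axis {bottom} l′ (spokes-opposite l l′)

spokes-cross : ∀ h h′ r r′ → ¬ (2 + r ≡ 2 + r′ × hub h ≡ hub h′) → ∀ p →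
  OnEdge (spoke h r) p → OnEdge (spoke h′ r′) p → SharedEndpoint position (2 + r) (hub h) (2 + r′) (hub h′) p
spokes-cross top    top    r r′ ne p l l′ =
  0 , inj₂ refl , inj₂ refl , spokes-same-hub top (λ r≡r′ → ne (cong (2 +_) r≡r′ , refl)) p l l′
spokes-cross bottom bottom r r′ ne p l l′ =
  1 , inj₂ refl , inj₂ refl , spokes-same-hub bottom (λ r≡r′ → ne (cong (2 +_) r≡r′ , refl)) p l l′
spokes-cross top    bottom r r′ ne p l l′ = opposite-spokes-cross r r′ p l l′
spokes-cross bottom top    r r′ ne p l l′ = SharedEndpoint-swap (opposite-spokes-cross r′ r p l′ l)

rims-consecutive : ∀ {j j′} → j < j′ → ∀ p → OnEdge (rim j) p → OnEdge (rim j′) p →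
  SharedEndpoint position (3 + j) (2 + j) (3 + j′) (2 + j′) p
rims-consecutive {j} {j′} j<j′ (x , y) (t , _ , t≤1 , ex , _) l′@(s , 0≤s , _ , ex′ , _) =
  2 + j′ , inj₁ (proj₁ touch) , inj₂ refl , rim-start l′ (proj₂ touch)
  where
  touch : 2 + j′ ≡ 3 + j × s ≡ 0ℚ
  touch = fromℕ-unit-overlap (2 + j) (2 + j′) (trans (sym ex) ex′) t≤1 0≤s (s≤s (s≤s j<j′))

rims-cross : ∀ j j′ → j ≢ j′ → ∀ p → OnEdge (rim j) p → OnEdge (rim j′) p →
  SharedEndpoint position (3 + j) (2 + j) (3 + j′) (2 + j′) p
rims-cross j j′ j≢j′ p l l′ with <-cmp j j′
... | tri< j<j′ _ _ = rims-consecutive j<j′ p l l′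
... | tri≈ _ j≡j′ _ = ⊥-elim (j≢j′ j≡j′)
... | tri> _ _ j′<j = SharedEndpoint-swap (rims-consecutive j′<j p l′ l)

edge-crossing : ∀ {a b c d} (e : Edge a b) (e′ : Edge c d) → ¬ (a ≡ c × b ≡ d) → ∀ p →
  OnEdge e p → OnEdge e′ p → SharedEndpoint position a b c d p
edge-crossing axle        axle          ne _       _ _  = ⊥-elim (ne (refl , refl))
edge-crossing axle        (spoke h r)   _  p       l l′ = axle-spoke-cross h r p l l′
edge-crossing axle        (rim j)       _  (x , y) l l′ = ⊥-elim (rim-off-y-axis l′ l)
edge-crossing (spoke h r) axle          _  p       l l′ = SharedEndpoint-swap (axle-spoke-cross h r p l′ l)
edge-crossing (spoke h r) (spoke h′ r′) ne p       l l′ = spokes-cross h h′ r r′ ne p l l′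
edge-crossing (spoke h r) (rim j)       _  p       l l′ = spoke-rim-cross h r j p l l′
edge-crossing (rim j)     axle          _  (x , y) l l′ = ⊥-elim (rim-off-y-axis l l′)
edge-crossing (rim j)     (spoke h r)   _  p       l l′ = SharedEndpoint-swap (spoke-rim-cross h r j p l′ l)
edge-crossing (rim j)     (rim j′)      ne p       l l′ =
  rims-cross j j′ (λ j≡j′ → ne (cong (3 +_) j≡j′ , cong (2 +_) j≡j′)) p l l′

module DoubleFan (k : ℕ) where

  open Restriction (fanAdj k) (fanAdj-sym k) (fanAdj-irrefl k) public

  rim-lower-neighbours : ∀ {j} → j < k → ∀ v → v < 2 + j → fanAdj k (2 + j) v ≡ previousOrHub j v
  rim-lower-neighbours {j} j<k v v<2+j =
    trans (fanAdj-below k v<2+j) (cong (_∧ previousOrHub j v) (dec-true (j <? k) j<k))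

  isolated-lower-neighbours : ∀ {j} → k ≤ j → ∀ v → v < 2 + j → fanAdj k (2 + j) v ≡ false
  isolated-lower-neighbours {j} k≤j v v<2+j =
    trans (fanAdj-below k v<2+j) (cong (_∧ previousOrHub j v) (dec-false (j <? k) (≤⇒≯ k≤j)))

  rim-degree : ∀ {j} → suc j < k → countBelow (fanAdj k (3 + j)) (3 + j) ≡ 3
  rim-degree {j} 1+j<k = begin
    countBelow (fanAdj k (3 + j)) (3 + j)
      ≡⟨ countBelow-cong (3 + j) (rim-lower-neighbours 1+j<k) ⟩
    indicator (does (j ≟ℕ j)) + countBelow (previousOrHub (suc j)) (2 + j)
      ≡⟨ cong₂ _+_ (cong indicator (dec-true (j ≟ℕ j) refl)) (cong (countBelow _) (+-comm 2 j)) ⟩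
    1 + countBelow (previousOrHub (suc j)) (j + 2)
      ≡⟨ cong (1 +_) (countBelow-skip 2 j (previousOrHub-gap j)) ⟩
    3 ∎
    where open ≡-Reasoning

  isolated-degree : ∀ u → 2 + k ≤ u → countBelow (fanAdj k u) u ≡ 0
  isolated-degree (suc (suc j)) (s≤s (s≤s k≤j)) = countBelow-empty (2 + j) (isolated-lower-neighbours k≤j)

  rim-edges : ∀ j → j < k → edgeCount (restrict (3 + j)) ≡ 3 * suc j
  rim-edges zero    0<k   =
    trans (edgeCount-restrict-suc 2) (cong (_+ 1) (countBelow-cong 2 (rim-lower-neighbours 0<k)))
  rim-edges (suc j) 1+j<k = begin
    edgeCount (restrict (4 + j))
      ≡⟨ edgeCount-restrict-suc (3 + j) ⟩
    countBelow (fanAdj k (3 + j)) (3 + j) + edgeCount (restrict (3 + j))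
      ≡⟨ cong₂ _+_ (rim-degree 1+j<k) (rim-edges j (<⇒≤ 1+j<k)) ⟩
    3 + 3 * suc j
      ≡⟨ *-suc 3 (suc j) ⟨
    3 * suc (suc j) ∎
    where open ≡-Reasoning

  isolated-edges : ∀ d → edgeCount (restrict (d + (2 + k))) ≡ edgeCount (restrict (2 + k))
  isolated-edges zero    = refl
  isolated-edges (suc d) = trans (edgeCount-restrict-suc (d + (2 + k)))
    (cong₂ _+_ (isolated-degree (d + (2 + k)) (m≤n+m (2 + k) d)) (isolated-edges d))

  hub-pair-cliques : ∀ P → P 0 ≡ true → P 1 ≡ true → cliquesWithin 2 P ≡ 4
  hub-pair-cliques P p0 p1 rewrite p0 | p1 = refl

  triangle-link : ∀ {j P} → j < k → P 0 ≡ true → P 1 ≡ true → P (2 + j) ≡ true →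
    (∀ x → 2 ≤ x → x < j + 2 → P x ≡ false) → cliquesWithin (3 + j) P ≡ 8
  triangle-link {j} {P} j<k p0 p1 p2+j gap rewrite p2+j = begin
    cliquesWithin (2 + j) P + cliquesWithin (2 + j) (P ∩ fanAdj k (2 + j))
      ≡⟨ cong (λ n → cliquesWithin n P + cliquesWithin n (P ∩ fanAdj k (2 + j))) (+-comm 2 j) ⟩
    cliquesWithin (j + 2) P + cliquesWithin (j + 2) (P ∩ fanAdj k (2 + j))
      ≡⟨ cong₂ _+_ (cliquesWithin-skip 2 j gap)
                   (cliquesWithin-skip 2 j λ x 2≤x x<j+2 → cong (_∧ _) (gap x 2≤x x<j+2)) ⟩
    cliquesWithin 2 P + cliquesWithin 2 (P ∩ fanAdj k (2 + j))
      ≡⟨ cong₂ _+_ (hub-pair-cliques P p0 p1)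
                   (hub-pair-cliques (P ∩ fanAdj k (2 + j))
                     (∧-intro p0 (rim-lower-neighbours j<k 0 (s≤s z≤n)))
                     (∧-intro p1 (rim-lower-neighbours j<k 1 (s≤s (s≤s z≤n))))) ⟩
    8 ∎
    where open ≡-Reasoning

  rim-link : ∀ {j} → suc j < k → cliquesWithin (3 + j) (fanAdj k (3 + j)) ≡ 8
  rim-link {j} 1+j<k = trans (cliquesWithin-cong (3 + j) (rim-lower-neighbours 1+j<k))
    (triangle-link (<⇒≤ 1+j<k) refl refl (dec-true (j ≟ℕ j) refl) (previousOrHub-gap j))

  isolated-link : ∀ u → 2 + k ≤ u → cliquesWithin u (fanAdj k u) ≡ 1
  isolated-link (suc (suc j)) (s≤s (s≤s k≤j)) = cliquesWithin-empty (2 + j) (isolated-lower-neighbours k≤j)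

  rim-cliques : ∀ j → j < k → cliquesWithin (3 + j) (λ _ → true) ≡ 8 * suc j
  rim-cliques zero    0<k   = cong (4 +_) (hub-pair-cliques (fanAdj k 2)
    (rim-lower-neighbours 0<k 0 (s≤s z≤n)) (rim-lower-neighbours 0<k 1 (s≤s (s≤s z≤n))))
  rim-cliques (suc j) 1+j<k = trans (cong₂ _+_ (rim-cliques j (<⇒≤ 1+j<k)) (rim-link 1+j<k))
    (trans (+-comm (8 * suc j) 8) (sym (*-suc 8 (suc j))))

  isolated-cliques : ∀ d →
    cliquesWithin (d + (2 + k)) (λ _ → true) ≡ d + cliquesWithin (2 + k) (λ _ → true)
  isolated-cliques zero    = refl
  isolated-cliques (suc d) =
    trans (cong₂ _+_ (isolated-cliques d) (isolated-link (d + (2 + k)) (m≤n+m (2 + k) d))) (+-comm _ 1)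

  fanEdge-view : ∀ {u v} → fanEdge k u v ≡ true → Edge u v
  fanEdge-view {1}           {0} _ = axle
  fanEdge-view {suc (suc j)} {v} e = previousOrHub-view j v (proj₂ (∧-true {does (j <? k)} e))
    where
    previousOrHub-view : ∀ j v → previousOrHub j v ≡ true → Edge (2 + j) v
    previousOrHub-view j       0             _ = spoke top j
    previousOrHub-view j       1             _ = spoke bottom j
    previousOrHub-view (suc j) (suc (suc w)) e rewrite dec-true⁻¹ (w ≟ℕ j) e = rim j

  doubleFan-drawing : StraightLineDrawing (fanAdj k)
  doubleFan-drawing = oriented-drawing (fanEdge k) position position-injective
    (λ w u v e s → vertex-on-edge (fanEdge-view e) w (edge-locus (fanEdge-view e) (position w) s))
    (λ a b c d e e′ ne p s s′ → edge-crossing (fanEdge-view e) (fanEdge-view e′) ne p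
                                  (edge-locus (fanEdge-view e) p s) (edge-locus (fanEdge-view e′) p s′))

  doubleFan-planar : ∀ n → Planar (restrict n)
  doubleFan-planar = restrict-planar doubleFan-drawing

doubleFan-edgeCount : ∀ k d → edgeCount (DoubleFan.restrict (suc k) (d + (3 + k))) ≡ 3 * suc k
doubleFan-edgeCount k d = trans (isolated-edges d) (rim-edges k ≤-refl)
  where open DoubleFan (suc k)

doubleFan-cliqueCount : ∀ k d →
  cliqueCount (DoubleFan.restrict (suc k) (d + (3 + k))) + 2 ≡ d + (3 + k) + 7 * suc k
doubleFan-cliqueCount k d = begin
  cliqueCount (restrict (d + (3 + k))) + 2      ≡⟨ cong (_+ 2) (cliqueCount-restrict (d + (3 + k))) ⟩
  cliquesWithin (d + (3 + k)) (λ _ → true) + 2  ≡⟨ cong (_+ 2) (isolated-cliques d) ⟩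
  d + cliquesWithin (3 + k) (λ _ → true) + 2    ≡⟨ cong (λ c → d + c + 2) (rim-cliques k ≤-refl) ⟩
  d + 8 * suc k + 2                             ≡⟨ arithmetic d k ⟩
  d + (3 + k) + 7 * suc k                       ∎
  where
  open DoubleFan (suc k)
  open ≡-Reasoning
  arithmetic : ∀ d k → d + 8 * suc k + 2 ≡ d + (3 + k) + 7 * suc k
  arithmetic = solve-∀

doubleFan-realises : ∀ k n → 3 + k ≤ n →
  Σ (Graph n) λ G → Planar G × (edgeCount G ≡ 3 * suc k) × (cliqueCount G + 2 ≡ n + 7 * suc k)
doubleFan-realises k n 3+k≤n = subst Realisation (m∸n+n≡m 3+k≤n)
  (restrict (d + (3 + k)) , doubleFan-planar _ , doubleFan-edgeCount k d , doubleFan-cliqueCount k d)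
  where
  open DoubleFan (suc k)
  d = n ∸ (3 + k)
  Realisation : ℕ → Set
  Realisation n = Σ (Graph n) λ G →
    Planar G × (edgeCount G ≡ 3 * suc k) × (cliqueCount G + 2 ≡ n + 7 * suc k)

proposition7 : (n m : ℕ) → 3 ≤ n → 3 ∣ m → 3 ≤ m → m + 6 ≤ 3 * n →
    Σ (Graph n) λ G → Planar G × (edgeCount G ≡ m) × (3 * cliqueCount G + 6 ≡ 3 * n + 7 * m)
proposition7 n .(zero * 3)  _ (divides zero    refl) () _
proposition7 n .(suc k * 3) _ (divides (suc k) refl) _  m+6≤3n =
  let G , planar , edges , cliques = doubleFan-realises k n 3+k≤n
  in  G , planar , trans edges (*-comm 3 (suc k)) ,
      trans (sym (tripled-left (cliqueCount G))) (trans (cong (3 *_) cliques) (tripled-right n k))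
  where
  size-bound : ∀ k → suc k * 3 + 6 ≡ 3 * (3 + k)
  size-bound = solve-∀
  tripled-left : ∀ c → 3 * (c + 2) ≡ 3 * c + 6
  tripled-left = solve-∀
  tripled-right : ∀ n k → 3 * (n + 7 * suc k) ≡ 3 * n + 7 * (suc k * 3)
  tripled-right = solve-∀
  3+k≤n : 3 + k ≤ n
  3+k≤n = *-cancelˡ-≤ 3 (subst (_≤ 3 * n) (size-bound k) m+6≤3n)
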